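{- For every integer $n\ge 1$, each of the sets $\mathcal{S}_n(1\text{ - }23,\,23\text{ - }1)$, $\mathcal{S}_n(3\text{ - }21,\,21\text{ - }3)$, $\mathcal{S}_n(12\text{ - }3,\,3\text{ - }12)$, $\mathcal{S}_n(32\text{ - }1,\,1\text{ - }32)$ has cardinality $2^{n-1}$.
   Context: A permutation of $[n]=\{1,\dots,n\}$ is written as a word $\pi=a_1a_2\cdots a_n$. For a permutation $xyz$ of $\{1,2,3\}$: $\pi$ contains the pattern $x\text{ - }yz$ if there are indices $1\le i<j<n$ such that $a_i,a_j,a_{j+1}$ are in the same relative order as $x,y,z$; $\pi$ contains the pattern $xy\text{ - }z$ if there are indices $i$ and $k$ with $i+1<k\le n$ such that $a_i,a_{i+1},a_k$ are in the same relative order as $x,y,z$. $\pi$ avoids a pattern if it does not contain it. $\mathcal{S}_n(p,q)$ is the set of permutations of $[n]$ avoiding both $p$ and $q$. -}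

module Defs where

open import Data.Nat using (ℕ; _<_; _≤_; suc)
open import Data.Fin using (Fin; toℕ; inject₁; fromℕ<) renaming (_<_ to _<ᶠ_)
open import Data.Fin as F using ()
open import Data.Vec using (Vec; lookup; _∷_; [])
open import Data.List using (List; length)
open import Data.List.Membership.Propositional using (_∈_)
open import Data.List.Relation.Unary.Unique.Propositional using (Unique)
open import Data.Product using (Σ; ∃; ∃-syntax; _×_; _,_)
open import Function.Bundles using (_⇔_)
open import Function.Definitions using (Injective)
open import Relation.Binary.PropositionalEquality using (_≡_)
open import Relation.Nullary using (¬_)

-- A word a₀ a₁ … a_{n-1} over [n] (0-indexed positions and values; the
-- shift by one does not affect relative order).
Word : ℕ → Set
Word n = Vec (Fin n) n

-- A permutation of [n]: a word in which every letter appears at most once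
-- (hence, by pigeonhole, exactly once).
IsPerm : {n : ℕ} → Word n → Set
IsPerm {n} w = Injective _≡_ _≡_ (lookup w)

record Pat3 : Set where
  constructor pat
  field
    x y z : ℕ

SameOrder : Pat3 → ℕ → ℕ → ℕ → Set
SameOrder (pat x y z) u v w =
  ((u < v) ⇔ (x < y)) × ((v < u) ⇔ (y < x)) ×
  ((u < w) ⇔ (x < z)) × ((w < u) ⇔ (z < x)) ×
  ((v < w) ⇔ (y < z)) × ((w < v) ⇔ (z < y))

-- π contains x-yz: indices i < j with j+1 a valid position.
ContainsDashFirst : {n : ℕ} → Pat3 → Word n → Set
ContainsDashFirst {n} p w =
  ∃[ i ] ∃[ j ] Σ (suc (toℕ j) < n) λ j+1<n →
    (i <ᶠ j) × SameOrder p (toℕ (lookup w i)) (toℕ (lookup w j))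
                           (toℕ (lookup w (fromℕ< j+1<n)))

-- π contains xy-z: indices i, k with i+1 < k.
ContainsDashLast : {n : ℕ} → Pat3 → Word n → Set
ContainsDashLast {n} p w =
  ∃[ i ] ∃[ k ] Σ (suc (toℕ i) < n) λ i+1<n →
    (suc (suc (toℕ i)) ≤ toℕ k) ×
    SameOrder p (toℕ (lookup w i)) (toℕ (lookup w (fromℕ< i+1<n)))
                (toℕ (lookup w k))

Class₁ : {n : ℕ} → Word n → Set
Class₁ w = IsPerm w × ¬ ContainsDashFirst (pat 1 2 3) w × ¬ ContainsDashLast (pat 2 3 1) w
Class₂ : {n : ℕ} → Word n → Set
Class₂ w = IsPerm w × ¬ ContainsDashFirst (pat 3 2 1) w × ¬ ContainsDashLast (pat 2 1 3) w
Class₃ : {n : ℕ} → Word n → Set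
Class₃ w = IsPerm w × ¬ ContainsDashLast (pat 1 2 3) w × ¬ ContainsDashFirst (pat 3 1 2) w
Class₄ : {n : ℕ} → Word n → Set
Class₄ w = IsPerm w × ¬ ContainsDashLast (pat 3 2 1) w × ¬ ContainsDashFirst (pat 1 3 2) w

HasCard : {n : ℕ} → (Word n → Set) → ℕ → Set
HasCard {n} P c =
  Σ (List (Word n)) λ ws → Unique ws × (∀ w → (w ∈ ws) ⇔ P w) × (length ws ≡ c)

-- Avoiding both x-yz and yz-x means that no letter, wherever it sits outside an
-- adjacent factor u v, forms the pattern xyz together with u v.  For 1-23 and 23-1
-- this says that every ascent starts at the least letter 0 (otherwise 0 itself
-- completes an occurrence), so the permutation is a decreasing run, then 0, then a
-- decreasing run.  The largest letter therefore stands either in front or right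
-- after 0, and deleting it maps the class onto two copies of the class one size
-- smaller.  The other three classes are images of this one under complement and
-- reversal.
module Submission where

open import Defs
open import Data.Nat using (ℕ; zero; suc; _^_; _∸_; _≤_; _<_; _>_; _+_; z≤n; s≤s)
open import Data.Nat.Properties
open import Data.Fin as F using (Fin; toℕ; fromℕ<; punchOut)
open import Data.Fin.Properties using (toℕ-fromℕ<; toℕ<n; toℕ-injective; punchOut-injective; any?; injective⇒≤)
open import Data.Vec as Vec using (lookup)
open import Data.Vec.Properties using (tabulate-cong; tabulate∘lookup; lookup∘tabulate)
open import Data.List as List using (List; []; _∷_; [_]; length; map; _++_; reverse; _ʳ++_; downFrom)
open import Data.List.Properties as List using (length-map; length-++; map-∘; map-id-local; ∷-injectiveʳ; ∷-injectiveˡ; reverse-involutive)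
open import Data.List.Membership.Propositional using (_∈_)
open import Data.List.Membership.Propositional.Properties using (∈-map⁺; ∈-map⁻; ∈-tabulate⁺; ∈-tabulate⁻; ∈-++⁺ˡ; ∈-++⁺ʳ; ∈-++⁻; ∈-downFrom⁺; ∈-downFrom⁻)
open import Data.List.Membership.Propositional.Properties.WithK using (unique∧set⇒bag)
open import Data.List.Relation.Unary.Any using (here; there)
open import Data.List.Relation.Unary.All as All using (All; []; _∷_)
open import Data.List.Relation.Unary.All.Properties using (All¬⇒¬Any)
open import Data.List.Relation.Unary.Unique.Propositional using (Unique)
open import Data.List.Relation.Unary.AllPairs using ([]; _∷_)
open import Data.List.Relation.Unary.Unique.Propositional.Properties as Unique using (downFrom⁺)
open import Data.List.Relation.Unary.Linked as Linked using (Linked; []; [-]; _∷_)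
import Data.List.Relation.Unary.Linked.Properties as Linked
open import Data.List.Relation.Binary.Permutation.Propositional using (_↭_; ↭-refl; ↭-prep; ↭-swap; ↭-trans; ↭-sym; ↭⇒↭ₛ)
open import Data.List.Relation.Binary.Permutation.Propositional.Properties using (∈-resp-↭; drop-∷; ↭-reverse; ↭-length; ↭-singleton-inv; ¬x∷xs↭[])
open import Data.List.Relation.Binary.Permutation.Setoid.Properties using (Unique-resp-↭)
open import Data.List.Relation.Binary.BagAndSetEquality using (∼bag⇒↭)
open import Data.Product as Product using (Σ; ∃-syntax; _×_; _,_; proj₁; proj₂)
open import Data.Sum using (_⊎_; inj₁; inj₂)
open import Data.Empty using (⊥-elim)
open import Function using (_∘_; flip)
open import Function.Bundles using (_⇔_; mk⇔; Equivalence)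
open import Function.Definitions using (Injective)
open import Function.Properties.Equivalence using () renaming (trans to ⇔-trans)
open import Relation.Binary.PropositionalEquality using (_≡_; _≢_; refl; sym; trans; cong; cong₂; subst; setoid; module ≡-Reasoning)
open import Relation.Nullary using (¬_; yes; no)
open import Relation.Nullary.Negation using (_¬-⊎_)
open import Relation.Binary.Definitions using (tri<; tri≈; tri>)

open Equivalence using (to; from)

HasCardinality : {A : Set} → (A → Set) → ℕ → Set
HasCardinality {A} P c =
  Σ (List A) λ xs → Unique xs × (∀ x → (x ∈ xs) ⇔ P x) × (length xs ≡ c)

module _ {A B : Set} {P : A → Set} {Q : B → Set} (f : A → B) (g : B → A)
         (f-resp : ∀ {a} → P a → Q (f a)) (g-resp : ∀ {b} → Q b → P (g b))
         (g∘f≗id : ∀ {a} → P a → g (f a) ≡ a) (f∘g≗id : ∀ {b} → Q b → f (g b) ≡ b) where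

  HasCardinality-transfer : ∀ {c} → HasCardinality P c → HasCardinality Q c
  HasCardinality-transfer (xs , xs! , ∈xs⇔ , |xs|≡c) =
    map f xs , unique , (λ b → mk⇔ sound (complete b)) , trans (length-map f xs) |xs|≡c
    where
    g∘f-on-xs : map g (map f xs) ≡ xs
    g∘f-on-xs = trans (sym (map-∘ xs)) (map-id-local (All.tabulate (g∘f≗id ∘ to (∈xs⇔ _))))

    unique : Unique (map f xs)
    unique = Unique.map⁻ (subst Unique (sym g∘f-on-xs) xs!)

    sound : ∀ {b} → b ∈ map f xs → Q b
    sound b∈ with a , a∈ , refl ← ∈-map⁻ f b∈ = f-resp (to (∈xs⇔ a) a∈)

    complete : ∀ b → Q b → b ∈ map f xs
    complete b qb = subst (_∈ map f xs) (f∘g≗id qb) (∈-map⁺ f (from (∈xs⇔ (g b)) (g-resp qb)))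

PermList : ℕ → List ℕ → Set
PermList n l = l ↭ downFrom n

module _ {n : ℕ} {l : List ℕ} where

  PermList-∈ : PermList n l → ∀ {k} → k ∈ l ⇔ k < n
  PermList-∈ π = mk⇔ (∈-downFrom⁻ ∘ ∈-resp-↭ π) (∈-resp-↭ (↭-sym π) ∘ ∈-downFrom⁺)

  PermList-< : PermList n l → All (_< n) l
  PermList-< π = All.tabulate (to (PermList-∈ π))

  PermList-unique : PermList n l → Unique l
  PermList-unique π = Unique-resp-↭ (setoid ℕ) (↭⇒↭ₛ (↭-sym π)) (downFrom⁺ n)

  PermList-length : PermList n l → length l ≡ n
  PermList-length π = trans (↭-length π) (List.length-downFrom n)

  unique∧∈⇒PermList : Unique l → (∀ {k} → k ∈ l ⇔ k < n) → PermList n l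
  unique∧∈⇒PermList l! ∈l⇔ = ∼bag⇒↭ (unique∧set⇒bag l! (downFrom⁺ n)
    (mk⇔ (∈-downFrom⁺ ∘ to ∈l⇔) (from ∈l⇔ ∘ ∈-downFrom⁻)))

PermList⇒≤ : ∀ {m l} → PermList (suc m) l → All (_≤ m) l
PermList⇒≤ π = All.map (λ { (s≤s x≤m) → x≤m }) (PermList-< π)

-- Permutations whose ascents all start at 0

AscentStartsAt : (ℕ → ℕ → Set) → ℕ → ℕ → ℕ → Set
AscentStartsAt _≺_ e a b = a ≺ b → a ≡ e

insertAfterZero : ℕ → List ℕ → List ℕ
insertAfterZero M []           = [ M ]
insertAfterZero M (zero ∷ xs)  = zero ∷ M ∷ xs
insertAfterZero M (suc x ∷ xs) = suc x ∷ insertAfterZero M xs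

insertAfterZero-↭ : ∀ M xs → insertAfterZero M xs ↭ M ∷ xs
insertAfterZero-↭ M []           = ↭-refl
insertAfterZero-↭ M (zero ∷ xs)  = ↭-swap 0 M ↭-refl
insertAfterZero-↭ M (suc x ∷ xs) = ↭-trans (↭-prep (suc x) (insertAfterZero-↭ M xs)) (↭-swap (suc x) M ↭-refl)

head-insertAfterZero : ∀ {M xs} y ys → M ∷ xs ≡ insertAfterZero M (y ∷ ys) → M ≡ y
head-insertAfterZero zero    _ eq = ∷-injectiveˡ eq
head-insertAfterZero (suc _) _ eq = ∷-injectiveˡ eq

insertAfterZero-injective : ∀ M {xs ys} → insertAfterZero M xs ≡ insertAfterZero M ys → xs ≡ ys
insertAfterZero-injective M {[]}         {[]}         _  = refl
insertAfterZero-injective M {zero ∷ xs}  {zero ∷ ys}  eq = cong (0 ∷_) (∷-injectiveʳ (∷-injectiveʳ eq))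
insertAfterZero-injective M {suc x ∷ xs} {suc y ∷ ys} eq =
  cong₂ _∷_ (∷-injectiveˡ eq) (insertAfterZero-injective M (∷-injectiveʳ eq))
insertAfterZero-injective M {[]} {y ∷ ys} eq =
  ⊥-elim (0≢1+n (suc-injective (trans (cong length eq) (↭-length (insertAfterZero-↭ M (y ∷ ys))))))
insertAfterZero-injective M {x ∷ xs} {[]} eq =
  ⊥-elim (0≢1+n (suc-injective (trans (cong length (sym eq)) (↭-length (insertAfterZero-↭ M (x ∷ xs))))))

ZeroAscentPerm : ℕ → List ℕ → Set
ZeroAscentPerm m l = PermList (suc m) l × Linked (AscentStartsAt _<_ 0) l

Linked-cons-max : ∀ {M xs} → All (_< M) xs → Linked (AscentStartsAt _<_ 0) xs →
                  Linked (AscentStartsAt _<_ 0) (M ∷ xs)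
Linked-cons-max []          []  = [-]
Linked-cons-max (x<M ∷ _)   lk  = (λ M<x → ⊥-elim (<-asym x<M M<x)) ∷ lk

insertAfterZero-Linked : ∀ {M} xs → All (_< M) xs → 0 ∈ xs → Linked (AscentStartsAt _<_ 0) xs →
                         Linked (AscentStartsAt _<_ 0) (insertAfterZero M xs)
insertAfterZero-Linked (zero ∷ xs) (_ ∷ xs<M) _ lk = (λ _ → refl) ∷ Linked-cons-max xs<M (Linked.tail lk)
insertAfterZero-Linked (suc x ∷ zero ∷ xs) (_ ∷ xs<M) (there 0∈) (r ∷ lk) =
  r ∷ insertAfterZero-Linked (zero ∷ xs) xs<M 0∈ lk
insertAfterZero-Linked (suc x ∷ suc y ∷ xs) (_ ∷ xs<M) (there 0∈) (r ∷ lk) =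
  r ∷ insertAfterZero-Linked (suc y ∷ xs) xs<M 0∈ lk

insertAfterZero-Linked⁻ : ∀ {M} xs → Linked (AscentStartsAt _<_ 0) (insertAfterZero M xs) →
                          Linked (AscentStartsAt _<_ 0) xs
insertAfterZero-Linked⁻ []                   _             = []
insertAfterZero-Linked⁻ (zero ∷ [])          _             = [-]
insertAfterZero-Linked⁻ (zero ∷ y ∷ xs)      (_ ∷ _ ∷ lk)  = (λ _ → refl) ∷ lk
insertAfterZero-Linked⁻ (suc x ∷ [])         _             = [-]
insertAfterZero-Linked⁻ (suc x ∷ zero ∷ xs)  (r ∷ lk)      = r ∷ insertAfterZero-Linked⁻ (zero ∷ xs) lk
insertAfterZero-Linked⁻ (suc x ∷ suc y ∷ xs) (r ∷ lk)      = r ∷ insertAfterZero-Linked⁻ (suc y ∷ xs) lk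

max-decomposition : ∀ {M l} → M ∈ l → All (_≤ M) l → Unique l → Linked (AscentStartsAt _<_ 0) l →
                    (∃[ t ] l ≡ M ∷ t) ⊎ (∃[ t ] l ≡ insertAfterZero M t)
max-decomposition {M} {x ∷ t} M∈l ≤M l! lk with x ≟ M | M∈l
... | yes refl | _         = inj₁ (t , refl)
... | no x≢M   | here M≡x  = ⊥-elim (x≢M (sym M≡x))
... | no _     | there M∈t = inj₂ (Product.map₂ proj₂ (maxInTail M∈t ≤M l! lk))
  where
  -- The letter before M is smaller, hence 0; the invariant 0 ∈ t′ rules out x ≡ 0 further left.
  maxInTail : ∀ {x t} → M ∈ t → All (_≤ M) (x ∷ t) → Unique (x ∷ t) →
              Linked (AscentStartsAt _<_ 0) (x ∷ t) →
               ∃[ t′ ] 0 ∈ t′ × x ∷ t ≡ insertAfterZero M t′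
  maxInTail {t = M ∷ t} (here refl) (x≤M ∷ _) ((x≢M ∷ _) ∷ _) (x≡0 ∷ _)
    with refl ← x≡0 (≤∧≢⇒< x≤M x≢M) = 0 ∷ t , here refl , refl
  maxInTail {x} {y ∷ t} (there M∈t) (_ ∷ ≤M) (x∉ ∷ y∷t!) (_ ∷ lk)
    with t′ , 0∈t′ , eq ← maxInTail M∈t ≤M y∷t! lk | x
  ... | zero   = ⊥-elim (All¬⇒¬Any x∉ (subst (0 ∈_) (sym eq)
                   (∈-resp-↭ (↭-sym (insertAfterZero-↭ M t′)) (there 0∈t′))))
  ... | suc x′ = suc x′ ∷ t′ , there 0∈t′ , cong (suc x′ ∷_) eq

zeroAscentPerms : ℕ → List (List ℕ)
zeroAscentPerms zero    = [ [ 0 ] ]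
zeroAscentPerms (suc m) = map (suc m ∷_) (zeroAscentPerms m) ++ map (insertAfterZero (suc m)) (zeroAscentPerms m)

zeroAscentPerms-sound : ∀ m {l} → l ∈ zeroAscentPerms m → ZeroAscentPerm m l
zeroAscentPerms-sound zero (here refl) = ↭-refl , [-]
zeroAscentPerms-sound (suc m) l∈ with ∈-++⁻ (map (suc m ∷_) (zeroAscentPerms m)) l∈
... | inj₁ l∈₁ with l , l∈ , refl ← ∈-map⁻ (suc m ∷_) l∈₁ =
  let π , lk = zeroAscentPerms-sound m l∈ in
  ↭-prep (suc m) π , Linked-cons-max (PermList-< π) lk
... | inj₂ l∈₂ with l , l∈ , refl ← ∈-map⁻ (insertAfterZero (suc m)) l∈₂ =
  let π , lk = zeroAscentPerms-sound m l∈ in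
  ↭-trans (insertAfterZero-↭ (suc m) l) (↭-prep (suc m) π) ,
  insertAfterZero-Linked l (PermList-< π) (from (PermList-∈ π) (s≤s z≤n)) lk

zeroAscentPerms-complete : ∀ m {l} → ZeroAscentPerm m l → l ∈ zeroAscentPerms m
zeroAscentPerms-complete zero (π , _) with refl ← ↭-singleton-inv π = here refl
zeroAscentPerms-complete (suc m) (π , lk)
  with max-decomposition (from (PermList-∈ π) ≤-refl) (PermList⇒≤ π) (PermList-unique π) lk
... | inj₁ (t , refl) =
  ∈-++⁺ˡ (∈-map⁺ (suc m ∷_) (zeroAscentPerms-complete m (drop-∷ π , Linked.tail lk)))
... | inj₂ (t , refl) =
  ∈-++⁺ʳ (map (suc m ∷_) (zeroAscentPerms m)) (∈-map⁺ (insertAfterZero (suc m))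
    (zeroAscentPerms-complete m (drop-∷ (↭-trans (↭-sym (insertAfterZero-↭ (suc m) t)) π) ,
                                insertAfterZero-Linked⁻ t lk)))

zeroAscentPerms-unique : ∀ m → Unique (zeroAscentPerms m)
zeroAscentPerms-unique zero    = [] ∷ []
zeroAscentPerms-unique (suc m) =
  Unique.++⁺ (Unique.map⁺ ∷-injectiveʳ (zeroAscentPerms-unique m))
             (Unique.map⁺ (insertAfterZero-injective (suc m)) (zeroAscentPerms-unique m))
             disjoint
  where
  -- A list of the second kind starts with its original head, which is below M.
  disjoint : ∀ {v} → ¬ (v ∈ map (suc m ∷_) (zeroAscentPerms m) ×
                        v ∈ map (insertAfterZero (suc m)) (zeroAscentPerms m))
  disjoint (v∈₁ , v∈₂) with ∈-map⁻ (suc m ∷_) v∈₁ | ∈-map⁻ (insertAfterZero (suc m)) v∈₂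
  ... | _ , _ , refl | l , l∈ , eq with l | proj₁ (zeroAscentPerms-sound m l∈)
  ...   | []    | π = ¬x∷xs↭[] (↭-sym π)
  ...   | y ∷ t | π with refl ← head-insertAfterZero y t eq = <-irrefl refl (to (PermList-∈ π) (here refl))

zeroAscentPerms-length : ∀ m → length (zeroAscentPerms m) ≡ 2 ^ m
zeroAscentPerms-length zero    = refl
zeroAscentPerms-length (suc m) = begin
  length (map (suc m ∷_) E ++ map (insertAfterZero (suc m)) E)
    ≡⟨ length-++ (map (suc m ∷_) E) ⟩
  length (map (suc m ∷_) E) + length (map (insertAfterZero (suc m)) E)
    ≡⟨ cong₂ _+_ (length-map _ E) (length-map _ E) ⟩
  length E + length E
    ≡⟨ cong (λ k → k + k) (zeroAscentPerms-length m) ⟩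
  2 ^ m + 2 ^ m
    ≡⟨ cong (2 ^ m +_) (sym (+-identityʳ (2 ^ m))) ⟩
  2 ^ suc m ∎
  where
  open ≡-Reasoning
  E = zeroAscentPerms m

zeroAscentPerm-card : ∀ m → HasCardinality (ZeroAscentPerm m) (2 ^ m)
zeroAscentPerm-card m = zeroAscentPerms m , zeroAscentPerms-unique m ,
  (λ l → mk⇔ (zeroAscentPerms-sound m) (zeroAscentPerms-complete m)) , zeroAscentPerms-length m

-- Complement and reversal

complement : ℕ → List ℕ → List ℕ
complement m = map (m ∸_)

complement-involutive : ∀ {m l} → All (_≤ m) l → complement m (complement m l) ≡ l
complement-involutive {l = l} ≤m = trans (sym (map-∘ l)) (map-id-local (All.map m∸[m∸n]≡n ≤m))

PermList-complement : ∀ {m l} → PermList (suc m) l → PermList (suc m) (complement m l)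
PermList-complement {m} {l} π = unique∧∈⇒PermList
  (Unique.map⁻ (subst Unique (sym (complement-involutive (PermList⇒≤ π))) (PermList-unique π)))
  (mk⇔ bounded (λ { (s≤s k≤m) → complete k≤m }))
  where
  bounded : ∀ {k} → k ∈ complement m l → k < suc m
  bounded k∈ with x , _ , refl ← ∈-map⁻ (m ∸_) k∈ = s≤s (m∸n≤m m x)

  complete : ∀ {k} → k ≤ m → k ∈ complement m l
  complete {k} k≤m = subst (_∈ complement m l) (m∸[m∸n]≡n k≤m)
                           (∈-map⁺ (m ∸_) (from (PermList-∈ π) (s≤s (m∸n≤m m k))))

m∸n<m∸o⇒o<n : ∀ m {n o} → m ∸ n < m ∸ o → o < n
m∸n<m∸o⇒o<n m lt = ≰⇒> (λ n≤o → <⇒≱ lt (∸-monoʳ-≤ m n≤o))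

Linked-complement⁺ : ∀ m {l} → Linked (AscentStartsAt _<_ 0) l → Linked (AscentStartsAt _>_ m) (complement m l)
Linked-complement⁺ m = Linked.map⁺ ∘ Linked.map λ asc lt → cong (m ∸_) (asc (m∸n<m∸o⇒o<n m lt))

Linked-complement⁻ : ∀ m {l} → Linked (AscentStartsAt _>_ m) l → Linked (AscentStartsAt _<_ 0) (complement m l)
Linked-complement⁻ m = Linked.map⁺ ∘ Linked.map λ asc lt →
  trans (cong (m ∸_) (asc (m∸n<m∸o⇒o<n m lt))) (n∸n≡0 m)

MaxDescentPerm : ℕ → List ℕ → Set
MaxDescentPerm m l = PermList (suc m) l × Linked (AscentStartsAt _>_ m) l

maxDescentPerm-card : ∀ m → HasCardinality (MaxDescentPerm m) (2 ^ m)
maxDescentPerm-card m = HasCardinality-transfer (complement m) (complement m)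
  (λ (π , lk) → PermList-complement π , Linked-complement⁺ m lk)
  (λ (π , lk) → PermList-complement π , Linked-complement⁻ m lk)
  (complement-involutive ∘ PermList⇒≤ ∘ proj₁)
  (complement-involutive ∘ PermList⇒≤ ∘ proj₁)
  (zeroAscentPerm-card m)

Linked-reverse : ∀ {R : ℕ → ℕ → Set} {xs} → Linked R xs → Linked (flip R) (reverse xs)
Linked-reverse {R} {[]}    _  = []
Linked-reverse {R} {_ ∷ _} lk = shunt lk [-]
  where
  shunt : ∀ {x xs acc} → Linked R (x ∷ xs) → Linked (flip R) (x ∷ acc) → Linked (flip R) (xs ʳ++ x ∷ acc)
  shunt [-]      acc = acc
  shunt (r ∷ lk) acc = shunt lk (r ∷ acc)

reverse-card : ∀ {n c} {R : ℕ → ℕ → Set} →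
               HasCardinality (λ l → PermList n l × Linked R l) c →
               HasCardinality (λ l → PermList n l × Linked (flip R) l) c
reverse-card = HasCardinality-transfer reverse reverse
  (λ {l} (π , lk) → ↭-trans (↭-reverse l) π , Linked-reverse lk)
  (λ {l} (π , lk) → ↭-trans (↭-reverse l) π , Linked-reverse lk)
  (λ {l} _ → reverse-involutive l)
  (λ {l} _ → reverse-involutive l)

letter : ∀ {n} → Word n → Fin n → ℕ
letter w i = toℕ (lookup w i)

asList : ∀ {n} → Word n → List ℕ
asList w = List.tabulate (letter w)

injective⇒surjective : ∀ {n} {f : Fin n → Fin n} → Injective _≡_ _≡_ f → ∀ y → ∃[ x ] f x ≡ y
injective⇒surjective {suc n} {f} f-inj y with any? (λ x → f x F.≟ y)
... | yes hit = hit
... | no miss = ⊥-elim (<-irrefl refl (injective⇒≤ punched-injective))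
  where
  y≢f : ∀ x → y ≢ f x
  y≢f x y≡fx = miss (x , sym y≡fx)

  punched : Fin (suc n) → Fin n
  punched x = punchOut (y≢f x)

  punched-injective : Injective _≡_ _≡_ punched
  punched-injective {a} {b} eq = f-inj (punchOut-injective (y≢f a) (y≢f b) eq)

letter-surjective : ∀ {n} (w : Word n) → IsPerm w → ∀ {k} → k < n → ∃[ i ] letter w i ≡ k
letter-surjective w w-perm {k} k<n with i , eq ← injective⇒surjective w-perm (fromℕ< k<n) =
  i , trans (cong toℕ eq) (toℕ-fromℕ< k<n)

Unique-tabulate⁻ : ∀ {n} {f : Fin n → ℕ} → Unique (List.tabulate f) → ∀ {i j} → f i ≡ f j → i ≡ j
Unique-tabulate⁻ _          {F.zero}  {F.zero}  _  = refl
Unique-tabulate⁻ (f₀∉ ∷ _)  {F.zero}  {F.suc j} eq = ⊥-elim (All.lookup f₀∉ (∈-tabulate⁺ j) eq)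
Unique-tabulate⁻ (f₀∉ ∷ _)  {F.suc i} {F.zero}  eq = ⊥-elim (All.lookup f₀∉ (∈-tabulate⁺ i) (sym eq))
Unique-tabulate⁻ (_ ∷ f!)   {F.suc i} {F.suc j} eq = cong F.suc (Unique-tabulate⁻ f! eq)

IsPerm⇔PermList : ∀ {n} (w : Word n) → IsPerm w ⇔ PermList n (asList w)
IsPerm⇔PermList {n} w = mk⇔
  (λ (w-perm : IsPerm w) →
     unique∧∈⇒PermList (Unique.tabulate⁺ (λ eq → w-perm (toℕ-injective eq))) (∈asList⇔ w-perm))
  (λ π eq → Unique-tabulate⁻ (PermList-unique π) (cong toℕ eq))
  where
  ∈asList⇔ : IsPerm w → ∀ {k} → k ∈ asList w ⇔ k < n
  ∈asList⇔ w-perm = mk⇔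
    (λ k∈ → let i , k≡ = ∈-tabulate⁻ k∈ in subst (_< n) (sym k≡) (toℕ<n (lookup w i)))
    (λ k<n → let i , eq = letter-surjective w w-perm k<n in subst (_∈ asList w) eq (∈-tabulate⁺ i))

at : List ℕ → ℕ → ℕ
at []       _       = 0
at (x ∷ _)  zero    = x
at (_ ∷ xs) (suc k) = at xs k

at-∈ : ∀ l {k} → k < length l → at l k ∈ l
at-∈ (x ∷ l) {zero}  _         = here refl
at-∈ (x ∷ l) {suc k} (s≤s k<) = there (at-∈ l k<)

at-tabulate : ∀ {n} (f : Fin n → ℕ) i → at (List.tabulate f) (toℕ i) ≡ f i
at-tabulate f F.zero    = refl
at-tabulate f (F.suc i) = at-tabulate (f ∘ F.suc) i

tabulate-at : ∀ {n} l → length l ≡ n → List.tabulate {n = n} (at l ∘ toℕ) ≡ l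
tabulate-at {zero}  []      _  = refl
tabulate-at {suc n} (x ∷ l) eq = cong (x ∷_) (tabulate-at l (suc-injective eq))

toFinOr : ∀ {n} → ℕ → Fin n → Fin n
toFinOr {n} k default with k <? n
... | yes k<n = fromℕ< k<n
... | no  _   = default

toℕ-toFinOr : ∀ {n k} (default : Fin n) → k < n → toℕ (toFinOr k default) ≡ k
toℕ-toFinOr {n} {k} _ k<n with k <? n
... | yes k<n′ = toℕ-fromℕ< k<n′
... | no  k≮n  = ⊥-elim (k≮n k<n)

-- An out-of-range letter is replaced by its position, an arbitrary dummy.
toWord : (n : ℕ) → List ℕ → Word n
toWord n l = Vec.tabulate λ i → toFinOr (at l (toℕ i)) i

toWord-asList : ∀ {n} (w : Word n) → toWord n (asList w) ≡ w
toWord-asList w = begin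
  Vec.tabulate (λ i → toFinOr (at (asList w) (toℕ i)) i)
    ≡⟨ tabulate-cong (λ i → cong (λ k → toFinOr k i) (at-tabulate (letter w) i)) ⟩
  Vec.tabulate (λ i → toFinOr (letter w i) i)
    ≡⟨ tabulate-cong (λ i → toℕ-injective (toℕ-toFinOr i (toℕ<n (lookup w i)))) ⟩
  Vec.tabulate (lookup w)
    ≡⟨ tabulate∘lookup w ⟩
  w ∎
  where open ≡-Reasoning

asList-toWord : ∀ {n l} → PermList n l → asList (toWord n l) ≡ l
asList-toWord {n} {l} π = begin
  List.tabulate (λ i → toℕ (lookup (toWord n l) i))
    ≡⟨ List.tabulate-cong (λ i → cong toℕ (lookup∘tabulate _ i)) ⟩
  List.tabulate (λ i → toℕ (toFinOr (at l (toℕ i)) i))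
    ≡⟨ List.tabulate-cong (λ i → toℕ-toFinOr i (at<n i)) ⟩
  List.tabulate (at l ∘ toℕ)
    ≡⟨ tabulate-at l (PermList-length π) ⟩
  l ∎
  where
  open ≡-Reasoning
  at<n : ∀ i → at l (toℕ i) < n
  at<n i = to (PermList-∈ π) (at-∈ l (subst (toℕ i <_) (sym (PermList-length π)) (toℕ<n i)))

HasCard-fromLists : ∀ {n c} {P : Word n → Set} {Q : List ℕ → Set} →
                    (∀ w → P w ⇔ (PermList n (asList w) × Q (asList w))) →
                    HasCardinality (λ l → PermList n l × Q l) c → HasCard P c
HasCard-fromLists {n} {Q = Q} P⇔ = HasCardinality-transfer (toWord n) asList
  (λ {l} πq@(π , _) →
     from (P⇔ (toWord n l)) (subst (λ l′ → PermList n l′ × Q l′) (sym (asList-toWord π)) πq))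
  (λ {w} → to (P⇔ w))
  (asList-toWord ∘ proj₁)
  (λ {w} _ → toWord-asList w)

module _ {A : Set} {R : A → A → Set} where

  Linked-tabulate⁺ : ∀ {n} {f : Fin n → A} → (∀ j (j+1<n : suc (toℕ j) < n) → R (f j) (f (fromℕ< j+1<n))) →
                     Linked R (List.tabulate f)
  Linked-tabulate⁺ {zero}        _   = []
  Linked-tabulate⁺ {suc zero}    _   = [-]
  Linked-tabulate⁺ {suc (suc n)} {f} adj =
    adj F.zero (s≤s (s≤s z≤n)) ∷ Linked-tabulate⁺ {f = f ∘ F.suc} (λ j j+1<n → adj (F.suc j) (s≤s j+1<n))

  Linked-tabulate⁻ : ∀ {n} {f : Fin n → A} → Linked R (List.tabulate f) →
                     ∀ j (j+1<n : suc (toℕ j) < n) → R (f j) (f (fromℕ< j+1<n))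
  Linked-tabulate⁻ {suc (suc n)} (r ∷ _)  F.zero    _             = r
  Linked-tabulate⁻ {suc (suc n)} {f} (_ ∷ lk) (F.suc j) (s≤s j+1<n) = Linked-tabulate⁻ {f = f ∘ F.suc} lk j j+1<n
  Linked-tabulate⁻ {suc zero}    _        F.zero    (s≤s ())

-- Pairs of dashed patterns

-- S x u v with u v an adjacent factor and x anywhere else: before it as in x-yz,
-- or after it as in yz-x.
ContainsAroundFactor : ∀ {n} → (ℕ → ℕ → ℕ → Set) → Word n → Set
ContainsAroundFactor {n} S w =
  ∃[ p ] ∃[ j ] Σ (suc (toℕ j) < n) λ j+1<n →
    p ≢ j × p ≢ fromℕ< j+1<n × S (letter w p) (letter w j) (letter w (fromℕ< j+1<n))

ContainsAroundFactor-cong : ∀ {n} {S T : ℕ → ℕ → ℕ → Set} (w : Word n) →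
                            (∀ {a b c} → S a b c ⇔ T a b c) → ContainsAroundFactor S w ⇔ ContainsAroundFactor T w
ContainsAroundFactor-cong w S⇔T = mk⇔
  (λ (p , j , j+1<n , p≢j , p≢j+1 , s) → p , j , j+1<n , p≢j , p≢j+1 , to S⇔T s)
  (λ (p , j , j+1<n , p≢j , p≢j+1 , t) → p , j , j+1<n , p≢j , p≢j+1 , from S⇔T t)

SameOrder-rotate : ∀ {x y z a b c} → SameOrder (pat x y z) a b c ⇔ SameOrder (pat y z x) b c a
SameOrder-rotate = mk⇔ (λ (A , B , C , D , E , F) → E , F , B , A , D , C)
                       (λ (E , F , B , A , D , C) → A , B , C , D , E , F)

SameOrder-swap₁₃ : ∀ {x y z a b c} → SameOrder (pat x y z) a b c ⇔ SameOrder (pat z y x) c b a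
SameOrder-swap₁₃ = mk⇔ (λ (A , B , C , D , E , F) → F , E , D , C , B , A)
                       (λ (A , B , C , D , E , F) → F , E , D , C , B , A)

SameOrder-swap₂₃ : ∀ {x y z a b c} → SameOrder (pat x y z) a b c ⇔ SameOrder (pat x z y) a c b
SameOrder-swap₂₃ = mk⇔ (λ (A , B , C , D , E , F) → C , D , A , B , F , E)
                       (λ (A , B , C , D , E , F) → C , D , A , B , F , E)

SameOrder-ascending : ∀ {x y z a b c} → x < y → y < z → SameOrder (pat x y z) a b c ⇔ (a < b × b < c)
SameOrder-ascending x<y y<z = mk⇔
  (λ (a<b⇔ , _ , _ , _ , b<c⇔ , _) → from a<b⇔ x<y , from b<c⇔ y<z)
  (λ (a<b , b<c) → let a<c = <-trans a<b b<c; x<z = <-trans x<y y<z in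
     holds a<b x<y , fails (<-asym a<b) (<-asym x<y) ,
     holds a<c x<z , fails (<-asym a<c) (<-asym x<z) ,
     holds b<c y<z , fails (<-asym b<c) (<-asym y<z))
  where
  holds : ∀ {A B : Set} → A → B → A ⇔ B
  holds a b = mk⇔ (λ _ → b) (λ _ → a)
  fails : ∀ {A B : Set} → ¬ A → ¬ B → A ⇔ B
  fails ¬a ¬b = mk⇔ (⊥-elim ∘ ¬a) (⊥-elim ∘ ¬b)

SameOrder-descending : ∀ {x y z a b c} → z < y → y < x → SameOrder (pat x y z) a b c ⇔ (b < a × c < b)
SameOrder-descending z<y y<x = mk⇔
  (Product.swap ∘ to (SameOrder-ascending z<y y<x) ∘ to SameOrder-swap₁₃)
  (from SameOrder-swap₁₃ ∘ from (SameOrder-ascending z<y y<x) ∘ Product.swap)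

dashPair⇔aroundFactor : ∀ {n} (w : Word n) {x y z} →
  (ContainsDashFirst (pat x y z) w ⊎ ContainsDashLast (pat y z x) w) ⇔
  ContainsAroundFactor (SameOrder (pat x y z)) w
dashPair⇔aroundFactor {n} w {x} {y} {z} = mk⇔ toAround fromAround
  where
  Dash = ContainsDashFirst (pat x y z) w ⊎ ContainsDashLast (pat y z x) w
  Around = ContainsAroundFactor (SameOrder (pat x y z)) w

  aroundAt : ∀ p j (j+1<n : suc (toℕ j) < n) → toℕ p ≢ toℕ j → toℕ p ≢ suc (toℕ j) →
             SameOrder (pat x y z) (letter w p) (letter w j) (letter w (fromℕ< j+1<n)) → Around
  aroundAt p j j+1<n ≢j ≢j+1 s =
    p , j , j+1<n , ≢j ∘ cong toℕ , (λ eq → ≢j+1 (trans (cong toℕ eq) (toℕ-fromℕ< j+1<n))) , s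

  toAround : Dash → Around
  toAround (inj₁ (i , j , j+1<n , i<j , so)) =
    aroundAt i j j+1<n (<⇒≢ i<j) (<⇒≢ (m<n⇒m<1+n i<j)) so
  toAround (inj₂ (i , k , i+1<n , i+1<k , so)) =
    aroundAt k i i+1<n (>⇒≢ (<-trans (n<1+n _) i+1<k)) (>⇒≢ i+1<k) (from SameOrder-rotate so)

  fromAround : Around → Dash
  fromAround (p , j , j+1<n , p≢j , p≢j+1 , s) with <-cmp (toℕ p) (toℕ j)
  ... | tri< p<j _ _ = inj₁ (p , j , j+1<n , p<j , s)
  ... | tri≈ _ p≡j _ = ⊥-elim (p≢j (toℕ-injective p≡j))
  ... | tri> _ _ j<p with m≤n⇒m<n∨m≡n j<p
  ...   | inj₁ j+1<p = inj₂ (j , p , j+1<n , j+1<p , to SameOrder-rotate s)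
  ...   | inj₂ j+1≡p = ⊥-elim (p≢j+1 (toℕ-injective (trans (sym j+1≡p) (sym (toℕ-fromℕ< j+1<n)))))

module _ (_≺_ : ℕ → ℕ → Set) (e : ℕ) {n} (w : Word n) (w-perm : IsPerm w) (e<n : e < n)
         (e≺ : ∀ {x} → x < n → x ≢ e → e ≺ x) (⊀e : ∀ {x} → x < n → ¬ x ≺ e) where

  private
    pₑ : Fin n
    pₑ = proj₁ (letter-surjective w w-perm e<n)

    letter-pₑ : letter w pₑ ≡ e
    letter-pₑ = proj₂ (letter-surjective w w-perm e<n)

    e-at : ∀ {i} → pₑ ≡ i → letter w i ≡ e
    e-at pₑ≡i = trans (cong (letter w) (sym pₑ≡i)) letter-pₑ

    e≺letter : ∀ {i} → letter w i ≢ e → e ≺ letter w i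
    e≺letter {i} = e≺ (toℕ<n (lookup w i))

    letter⊀e : ∀ {i} → ¬ letter w i ≺ e
    letter⊀e {i} = ⊀e (toℕ<n (lookup w i))

  avoidsAround123⇔ascentsStartAt : (¬ ContainsAroundFactor (λ x u v → x ≺ u × u ≺ v) w) ⇔
                                   Linked (AscentStartsAt _≺_ e) (asList w)
  avoidsAround123⇔ascentsStartAt = mk⇔
    (λ ¬around → Linked-tabulate⁺ (ascentStartsAt ¬around))
    (λ lk (p , j , j+1<n , _ , _ , x≺u , u≺v) →
       letter⊀e (subst (letter w p ≺_) (Linked-tabulate⁻ lk j j+1<n u≺v) x≺u))
    where
    -- Otherwise the letter e, wherever it stands outside u v, completes an occurrence.
    ascentStartsAt : ¬ ContainsAroundFactor (λ x u v → x ≺ u × u ≺ v) w → ∀ j j+1<n →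
                     AscentStartsAt _≺_ e (letter w j) (letter w (fromℕ< j+1<n))
    ascentStartsAt ¬around j j+1<n u≺v with letter w j ≟ e
    ... | yes u≡e = u≡e
    ... | no  u≢e = ⊥-elim (¬around (pₑ , j , j+1<n ,
          (u≢e ∘ e-at) ,
          (λ pₑ≡j+1 → letter⊀e (subst (letter w j ≺_) (e-at pₑ≡j+1) u≺v)) ,
          subst (_≺ letter w j) (sym letter-pₑ) (e≺letter u≢e) , u≺v))

  avoidsAround132⇔descentsEndAt : (¬ ContainsAroundFactor (λ x u v → x ≺ v × v ≺ u) w) ⇔
                                  Linked (flip (AscentStartsAt _≺_ e)) (asList w)
  avoidsAround132⇔descentsEndAt = mk⇔
    (λ ¬around → Linked-tabulate⁺ (descentEndsAt ¬around))
    (λ lk (p , j , j+1<n , _ , _ , x≺v , v≺u) →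
       letter⊀e (subst (letter w p ≺_) (Linked-tabulate⁻ lk j j+1<n v≺u) x≺v))
    where
    descentEndsAt : ¬ ContainsAroundFactor (λ x u v → x ≺ v × v ≺ u) w → ∀ j j+1<n →
                    flip (AscentStartsAt _≺_ e) (letter w j) (letter w (fromℕ< j+1<n))
    descentEndsAt ¬around j j+1<n v≺u with letter w (fromℕ< j+1<n) ≟ e
    ... | yes v≡e = v≡e
    ... | no  v≢e = ⊥-elim (¬around (pₑ , j , j+1<n ,
          (λ pₑ≡j → letter⊀e (subst (letter w (fromℕ< j+1<n) ≺_) (e-at pₑ≡j) v≺u)) ,
          (v≢e ∘ e-at) ,
          subst (_≺ letter w (fromℕ< j+1<n)) (sym letter-pₑ) (e≺letter v≢e) , v≺u))

avoidingDashPair⇔ : ∀ {n} (w : Word n) {x y z} {S : ℕ → ℕ → ℕ → Set} {R : ℕ → ℕ → Set} →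
  (∀ {a b c} → SameOrder (pat x y z) a b c ⇔ S a b c) →
  (IsPerm w → (¬ ContainsAroundFactor S w) ⇔ Linked R (asList w)) →
  (IsPerm w × ¬ ContainsDashFirst (pat x y z) w × ¬ ContainsDashLast (pat y z x) w) ⇔
  (PermList n (asList w) × Linked R (asList w))
avoidingDashPair⇔ w {x} {y} {z} {S} S⇔ char = mk⇔
  (λ (perm , ¬first , ¬last) →
     to (IsPerm⇔PermList w) perm , to (char perm) ((¬first ¬-⊎ ¬last) ∘ from dash⇔around))
  (λ (π , q) → let perm  = from (IsPerm⇔PermList w) π
                   ¬dash = from (char perm) q ∘ to dash⇔around
               in perm , ¬dash ∘ inj₁ , ¬dash ∘ inj₂)
  where
  dash⇔around : (ContainsDashFirst (pat x y z) w ⊎ ContainsDashLast (pat y z x) w) ⇔ ContainsAroundFactor S w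
  dash⇔around = ⇔-trans (dashPair⇔aroundFactor w) (ContainsAroundFactor-cong w (λ {a b c} → S⇔ {a} {b} {c}))

swap₂₃-⇔ : ∀ {A B C D : Set} → (A × B × C) ⇔ D → (A × C × B) ⇔ D
swap₂₃-⇔ A×B×C⇔D = mk⇔ (λ (a , c , b) → to A×B×C⇔D (a , b , c))
                           (λ d → let a , b , c = from A×B×C⇔D d in a , c , b)

module _ (m : ℕ) (w : Word (suc m)) where
  private
    below-max : ∀ {x} → x < suc m → x ≢ m → m > x
    below-max (s≤s x≤m) x≢m = ≤∧≢⇒< x≤m x≢m

    not-above-max : ∀ {x} → x < suc m → ¬ x > m
    not-above-max (s≤s x≤m) = ≤⇒≯ x≤m

  class₁ : Class₁ w ⇔ ZeroAscentPerm m (asList w)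
  class₁ = avoidingDashPair⇔ w (SameOrder-ascending ≤-refl ≤-refl)
    (λ perm → avoidsAround123⇔ascentsStartAt _<_ 0 w perm (s≤s z≤n) (λ _ → n≢0⇒n>0) (λ _ ()))

  class₂ : Class₂ w ⇔ MaxDescentPerm m (asList w)
  class₂ = avoidingDashPair⇔ w (SameOrder-descending ≤-refl ≤-refl)
    (λ perm → avoidsAround123⇔ascentsStartAt _>_ m w perm ≤-refl below-max not-above-max)

  class₃ : Class₃ w ⇔ (PermList (suc m) (asList w) × Linked (flip (AscentStartsAt _>_ m)) (asList w))
  class₃ = swap₂₃-⇔ (avoidingDashPair⇔ w (⇔-trans SameOrder-swap₂₃ (SameOrder-descending ≤-refl ≤-refl))
    (λ perm → avoidsAround132⇔descentsEndAt _>_ m w perm ≤-refl below-max not-above-max))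

  class₄ : Class₄ w ⇔ (PermList (suc m) (asList w) × Linked (flip (AscentStartsAt _<_ 0)) (asList w))
  class₄ = swap₂₃-⇔ (avoidingDashPair⇔ w (⇔-trans SameOrder-swap₂₃ (SameOrder-ascending ≤-refl ≤-refl))
    (λ perm → avoidsAround132⇔descentsEndAt _<_ 0 w perm (s≤s z≤n) (λ _ → n≢0⇒n>0) (λ _ ())))

mainTheorem5 : (n : ℕ) → 1 ≤ n →
    HasCard (Class₁ {n}) (2 ^ (n ∸ 1)) ×
    HasCard (Class₂ {n}) (2 ^ (n ∸ 1)) ×
    HasCard (Class₃ {n}) (2 ^ (n ∸ 1)) ×
    HasCard (Class₄ {n}) (2 ^ (n ∸ 1))
mainTheorem5 (suc m) _ =
  HasCard-fromLists (class₁ m) (zeroAscentPerm-card m) ,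
  HasCard-fromLists (class₂ m) (maxDescentPerm-card m) ,
  HasCard-fromLists (class₃ m) (reverse-card (maxDescentPerm-card m)) ,
  HasCard-fromLists (class₄ m) (reverse-card (zeroAscentPerm-card m))
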